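{- Let $F$ be a complete alternating shape with $n$ pipes and let $P$ be any pipe dream on $F$, with exit permutation $\omega$. Then: (1) for every pipe $p$, $x_p^s\le x_n^s<x_{\omega(1)}^e\le x_p^e$; (2) for every pipe $p$, $y_p^s\le y_1^s<y_{\omega(n)}^e\le y_p^e$; (3) $x_n^s\le e_F\le x_{\omega(1)}^e$; (4) $y_1^s\le 0\le y_{\omega(n)}^e$; (5) $e_F\le t_F+1$, where $e_F$ is the number of east steps of the starting path of $F$.
   Context: Grid cells are unit squares with corners in $\mathbb Z^2$, indexed by their lower-left corner. An alternating shape $F$ (with parameter $n\ge 2$) is a connected finite set of cells whose boundary splits into four paths: a starting path from $(0,0)$ made of $n$ unit steps, each south or east; a NW stair path from $(0,0)$ to $(t_F,t_F)$ with steps $(NE)^{t_F}$, $t_F\ge 0$; an ending path from $(t_F,t_F)$ made of $n$ unit steps, each south or east; and a SE stair path from the endpoint of the starting path to the endpoint of the ending path with steps $(EN)^{b}$, $b\ge0$; the ending path stays strictly north and east of the starting path. A pipe dream on $F$ fills each cell with either a cross (one pipe passing straight horizontally, one straight vertically) or a contact (one elbow joining the west side to the north side, one joining the south side to the east side), so that the $n$ pipes entering through the $n$ unit steps of the starting path exit through the $n$ unit steps of the ending path. Pipes are labelled $1,\dots,n$ by their entry step, from northwest to southeast along the starting path; the exit permutation $\omega$ is given by: $\omega(i)$ is the pipe exiting through the $i$-th step of the ending path (counted from northwest to southeast). A pipe dream is reduced if any two pipes cross at most once. A permutation is sortable on $F$ if it is the exit permutation of some reduced pipe dream on $F$; $F$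 is complete if the longest permutation $\omega_0=n\,(n-1)\cdots 2\,1$ is sortable on $F$. The starting coordinates $(x_p^s,y_p^s)$ of pipe $p$ are the coordinates of the southwest corner of its first cell; its ending coordinates $(x_p^e,y_p^e)$ are the coordinates of the northeast corner of its last cell. -}

module Defs where

open import Function using (_∘_)
open import Data.Nat as ℕ using (ℕ; zero; suc)
open import Data.Integer as ℤ using (ℤ; +_; _+_; _-_)
open import Data.Fin as Fin using (Fin; zero; suc; inject₁; fromℕ; toℕ)
open import Data.Product using (Σ; ∃; _×_; _,_; proj₁; proj₂)
open import Data.Sum using (_⊎_)
open import Data.List using (List; []; _∷_)
open import Data.List.Membership.Propositional using (_∈_)
open import Relation.Binary.PropositionalEquality using (_≡_; _≢_)

-- Lattice geometry.  Points are elements of ℤ²; a cell is indexed by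
-- its lower-left (south-west) corner.

Point : Set
Point = ℤ × ℤ

Cell : Set
Cell = ℤ × ℤ

data Step : Set where
  S E : Step

move : Point → Step → Point
move (x , y) S = (x , y - + 1)
move (x , y) E = (x + + 1 , y)

pathVertex : ∀ {n} → Point → (Fin n → Step) → Fin (suc n) → Point
pathVertex o s zero = o
pathVertex {suc n} o s (suc k) = pathVertex (move o (s zero)) (s ∘ suc) k

countE : ∀ {n} → (Fin n → Step) → ℕ
countE {zero} s = 0
countE {suc n} s with s zero
... | S = countE (s ∘ suc)
... | E = suc (countE (s ∘ suc))

-- Alternating shapes with parameter n.
-- start : steps of the starting path from (0,0)  (northwest to southeast)
-- t     : t_F, the NW stair path is (NE)^t from (0,0) to (t,t)
-- ending: steps of the ending path from (t,t)    (northwest to southeast)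
-- b     : the SE stair path is (EN)^b from the end of the starting path
--         to the end of the ending path.

startVertex : ∀ {n} → (Fin n → Step) → Fin (suc n) → Point
startVertex s = pathVertex (+ 0 , + 0) s

endVertex : ∀ {n} → ℕ → (Fin n → Step) → Fin (suc n) → Point
endVertex t s = pathVertex (+ t , + t) s

record AltShape (n : ℕ) : Set where
  field
    start  : Fin n → Step
    t      : ℕ
    ending : Fin n → Step
    b      : ℕ
    seStair : endVertex t ending (fromℕ n)
              ≡ (proj₁ (startVertex start (fromℕ n)) + + b ,
                 proj₂ (startVertex start (fromℕ n)) + + b)
    -- the ending path stays strictly north and east of the starting path:
    -- the k-th vertices of the two paths (which lie on the same diagonal
    -- x - y = k) are distinct and ordered, for every interior k
    strict : ∀ (k : Fin (suc n)) → 0 ℕ.< toℕ k → toℕ k ℕ.< n →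
             proj₁ (startVertex start k) ℤ.< proj₁ (endVertex t ending k)

module _ {n : ℕ} (F : AltShape n) where
  open AltShape F

  Pv : Fin (suc n) → Point
  Pv = startVertex start

  Qv : Fin (suc n) → Point
  Qv = endVertex t ending

  eF : ℕ
  eF = countE start

  -- vertical boundary edge at abscissa x in row j (between y = j and j+1)
  -- belonging to the left part of the boundary (starting path, NW stair)
  LeftEdge : ℤ → ℤ → Set
  LeftEdge x j =
      (∃ λ (k : Fin n) → start k ≡ S × Pv (inject₁ k) ≡ (x , j + + 1))
    ⊎ (∃ λ (i : ℕ) → i ℕ.< t × x ≡ + i × j ≡ + i)

  RightEdge : ℤ → ℤ → Set
  RightEdge x j =
      (∃ λ (k : Fin n) → ending k ≡ S × Qv (inject₁ k) ≡ (x , j + + 1))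
    ⊎ (∃ λ (m : ℕ) → m ℕ.< b ×
         x ≡ proj₁ (Pv (fromℕ n)) + + m + + 1 ×
         j ≡ proj₂ (Pv (fromℕ n)) + + m)

  -- the cells of F: those enclosed by the boundary, i.e. lying (in their
  -- row) weakly east of the left boundary and strictly west of the right one
  InF : Cell → Set
  InF (i , j) = (∃ λ x → LeftEdge x j × x ℤ.≤ i) × (∃ λ x → RightEdge x j × i ℤ.< x)

data Tile : Set where
  cross contact : Tile

data Dir : Set where
  east north : Dir

-- direction in which a pipe leaves a cell, given the direction in which it
-- entered (east = entered from the west side, north = from the south side)
out : Tile → Dir → Dir
out cross d = d
out contact east = north   -- west side joined to north side
out contact north = east   -- south side joined to east side

nextCell : Cell → Dir → Cell
nextCell (i , j) east  = (i + + 1 , j)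
nextCell (i , j) north = (i , j + + 1)

module _ {n : ℕ} (F : AltShape n) where
  open AltShape F

  -- first cell of pipe p (the cell adjacent to the p-th starting step)
  -- and the direction in which it enters that cell
  firstCell : Fin n → Cell
  firstCell p with start p | Pv F (inject₁ p)
  ... | S | (x , y) = (x , y - + 1)
  ... | E | (x , y) = (x , y)

  entryDir : Fin n → Dir
  entryDir p with start p
  ... | S = east
  ... | E = north

  -- the cell adjacent to the k-th step of the ending path
  -- (the last cell of the pipe exiting through that step)
  lastCell : Fin n → Cell
  lastCell k with ending k | Qv F (inject₁ k)
  ... | S | (x , y) = (x - + 1 , y - + 1)
  ... | E | (x , y) = (x , y - + 1)

  ExitsAt : Cell → Dir → Fin n → Set
  ExitsAt (i , j) east  k = ending k ≡ S × Qv F (inject₁ k) ≡ (i + + 1 , j + + 1)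
  ExitsAt (i , j) north k = ending k ≡ E × Qv F (inject₁ k) ≡ (i , j + + 1)

  -- Run P c d cs k : a pipe entering cell c in direction d runs through
  -- the list of cells cs (starting with c) and exits through ending step k
  data Run (P : Cell → Tile) : Cell → Dir → List Cell → Fin n → Set where
    done : ∀ {c d k} → ExitsAt c (out (P c) d) k → Run P c d (c ∷ []) k
    go   : ∀ {c d cs k} → InF F (nextCell c (out (P c) d)) →
           Run P (nextCell c (out (P c) d)) (out (P c) d) cs k →
           Run P c d (c ∷ cs) k

  Reaches : (Cell → Tile) → Fin n → Fin n → Set
  Reaches P p k = ∃ λ cs → Run P (firstCell p) (entryDir p) cs k

  -- P is a pipe dream on F with exit permutation ω:
  -- for every i, pipe ω(i) exits through the i-th step of the ending path
  IsPipeDream : (Cell → Tile) → (Fin n → Fin n) → Set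
  IsPipeDream P ω = ∀ i → Reaches P (ω i) i

  Visits : (Cell → Tile) → Fin n → Cell → Set
  Visits P p c = ∃ λ cs → ∃ λ k → Run P (firstCell p) (entryDir p) cs k × c ∈ cs

  CrossAt : (Cell → Tile) → Fin n → Fin n → Cell → Set
  CrossAt P p q c = P c ≡ cross × Visits P p c × Visits P q c

  Reduced : (Cell → Tile) → Set
  Reduced P = ∀ p q c c' → p ≢ q → CrossAt P p q c → CrossAt P p q c' → c ≡ c'

  -- complete: ω₀ = n (n-1) ⋯ 1 is sortable on F
  Complete : Set
  Complete = ∃ λ P → IsPipeDream P Fin.opposite × Reduced P

  -- starting coordinates of pipe p: south-west corner of its first cell
  xs ys : Fin n → ℤ
  xs p = proj₁ (firstCell p)
  ys p = proj₂ (firstCell p)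

  -- ending coordinates of the pipe exiting through the i-th ending step
  -- (i.e. of pipe ω(i)): north-east corner of its last cell
  xe ye : Fin n → ℤ
  xe i = proj₁ (lastCell i) + + 1
  ye i = proj₂ (lastCell i) + + 1

{-# OPTIONS --safe #-}
-- Both boundary paths are lattice paths going south and east, so x-coordinates
-- along them increase and y-coordinates decrease; the extreme starting and
-- ending coordinates therefore sit at the ends of the paths.  A pipe only ever
-- moves north or east, so it ends weakly north-east of its first cell.
-- Completeness provides a pipe dream with exit permutation ω₀, in which pipe n
-- leaves through the first ending step and pipe 1 through the last; this gives
-- the strict inequalities.  The bounds involving e_F, 0 and t_F compare a
-- single unit step at the start or end of a path.
module Submission where

open import Defs
open import Data.Nat as ℕ using (ℕ; suc; z≤n; s≤s)
open import Data.Integer as ℤ using (ℤ; +_; _+_; _-_; _≤_; _<_)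
import Data.Integer.Properties as ℤP
open import Data.Fin as Fin using (Fin; zero; suc; fromℕ; inject₁)
open import Data.Fin.Properties using (toℕ-inject₁; ≤fromℕ; opposite-involutive)
open import Function using (_∘_)
open import Data.Product using (_×_; _,_; proj₁; proj₂)
open import Relation.Binary.PropositionalEquality

i-1+1≡i : ∀ (i : ℤ) → i - + 1 + + 1 ≡ i
i-1+1≡i i = trans (ℤP.+-assoc i (ℤ.- + 1) (+ 1)) (ℤP.+-identityʳ i)

i+1-1≡i : ∀ (i : ℤ) → i + + 1 - + 1 ≡ i
i+1-1≡i i = trans (ℤP.+-assoc i (+ 1) (ℤ.- + 1)) (ℤP.+-identityʳ i)

i≤j⇒i<j+1 : ∀ {i j} → i ≤ j → i < j + + 1
i≤j⇒i<j+1 {i} {j} i≤j =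
  ℤP.suc[i]≤j⇒i<j (subst (_≤ j + + 1) (ℤP.+-comm i (+ 1)) (ℤP.+-monoˡ-≤ (+ 1) i≤j))

i<j⇒i+1≤j : ∀ {i j} → i < j → i + + 1 ≤ j
i<j⇒i+1≤j {i} {j} i<j = subst (_≤ j) (ℤP.+-comm (+ 1) i) (ℤP.i<j⇒suc[i]≤j i<j)

inject₁-mono : ∀ {n} {i j : Fin n} → i Fin.≤ j → inject₁ i Fin.≤ inject₁ j
inject₁-mono {i = i} {j} = subst₂ ℕ._≤_ (sym (toℕ-inject₁ i)) (sym (toℕ-inject₁ j))

move-x : ∀ o d → proj₁ o ≤ proj₁ (move o d) × proj₁ (move o d) ≤ proj₁ o + + 1
move-x (x , y) S = ℤP.≤-refl , ℤP.i≤i+j x (+ 1)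
move-x (x , y) E = ℤP.i≤i+j x (+ 1) , ℤP.≤-refl

move-y : ∀ o d → proj₂ (move o d) ≤ proj₂ o × proj₂ o ≤ proj₂ (move o d) + + 1
move-y (x , y) S = ℤP.i-j≤i y (+ 1) , ℤP.≤-reflexive (sym (i-1+1≡i y))
move-y (x , y) E = ℤP.≤-refl , ℤP.i≤i+j y (+ 1)

pathVertex-suc : ∀ {n} o (s : Fin n → Step) k →
                 pathVertex o s (suc k) ≡ move (pathVertex o s (inject₁ k)) (s k)
pathVertex-suc o s zero = refl
pathVertex-suc {suc n} o s (suc k) = pathVertex-suc (move o (s zero)) (s ∘ suc) k

pathVertex-mono : ∀ {n} o (s : Fin n → Step) {i j : Fin (suc n)} → i Fin.≤ j →
                  proj₁ (pathVertex o s i) ≤ proj₁ (pathVertex o s j) ×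
                  proj₂ (pathVertex o s j) ≤ proj₂ (pathVertex o s i)
pathVertex-mono o s {zero} {zero} _ = ℤP.≤-refl , ℤP.≤-refl
pathVertex-mono {suc n} o s {zero} {suc j} _
  with pathVertex-mono (move o (s zero)) (s ∘ suc) {zero} {j} z≤n
... | x≤ , y≥ = ℤP.≤-trans (proj₁ (move-x o (s zero))) x≤ ,
                ℤP.≤-trans y≥ (proj₁ (move-y o (s zero)))
pathVertex-mono {suc n} o s {suc i} {suc j} (s≤s i≤j) =
  pathVertex-mono (move o (s zero)) (s ∘ suc) i≤j

pathVertex-step-x : ∀ {n} o (s : Fin n → Step) k →
                    proj₁ (pathVertex o s (inject₁ k)) ≤ proj₁ (pathVertex o s (suc k)) ×
                    proj₁ (pathVertex o s (suc k)) ≤ proj₁ (pathVertex o s (inject₁ k)) + + 1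
pathVertex-step-x o s k rewrite pathVertex-suc o s k = move-x _ (s k)

pathVertex-step-y : ∀ {n} o (s : Fin n → Step) k →
                    proj₂ (pathVertex o s (suc k)) ≤ proj₂ (pathVertex o s (inject₁ k)) ×
                    proj₂ (pathVertex o s (inject₁ k)) ≤ proj₂ (pathVertex o s (suc k)) + + 1
pathVertex-step-y o s k rewrite pathVertex-suc o s k = move-y _ (s k)

pathVertex-countE : ∀ {n} o (s : Fin n → Step) →
                    proj₁ (pathVertex o s (fromℕ n)) ≡ proj₁ o + + countE s
pathVertex-countE {ℕ.zero} o s = sym (ℤP.+-identityʳ _)
pathVertex-countE {suc n} (x , y) s with s zero
... | S = pathVertex-countE (x , y - + 1) (s ∘ suc)
... | E = trans (pathVertex-countE (x + + 1 , y) (s ∘ suc))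
                (ℤP.+-assoc x (+ 1) (+ countE (s ∘ suc)))

module _ {n : ℕ} (F : AltShape n) where
  open AltShape F

  xs-vertex : ∀ k → xs F k ≡ proj₁ (Pv F (inject₁ k))
  xs-vertex k with start k | Pv F (inject₁ k)
  ... | S | _ = refl
  ... | E | _ = refl

  ys-vertex : ∀ k → ys F k ≡ proj₂ (Pv F (suc k))
  ys-vertex k rewrite pathVertex-suc (+ 0 , + 0) start k with start k | Pv F (inject₁ k)
  ... | S | _ = refl
  ... | E | _ = refl

  xe-vertex : ∀ k → xe F k ≡ proj₁ (Qv F (suc k))
  xe-vertex k rewrite pathVertex-suc (+ t , + t) ending k with ending k | Qv F (inject₁ k)
  ... | S | (x , _) = i-1+1≡i x
  ... | E | _ = refl

  ye-vertex : ∀ k → ye F k ≡ proj₂ (Qv F (inject₁ k))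
  ye-vertex k with ending k | Qv F (inject₁ k)
  ... | S | (_ , y) = i-1+1≡i y
  ... | E | (_ , y) = i-1+1≡i y

  xs-mono : ∀ {i j} → i Fin.≤ j → xs F i ≤ xs F j
  xs-mono {i} {j} i≤j rewrite xs-vertex i | xs-vertex j =
    proj₁ (pathVertex-mono _ start (inject₁-mono i≤j))

  ys-antitone : ∀ {i j} → i Fin.≤ j → ys F j ≤ ys F i
  ys-antitone {i} {j} i≤j rewrite ys-vertex i | ys-vertex j =
    proj₂ (pathVertex-mono _ start (s≤s i≤j))

  xe-mono : ∀ {i j} → i Fin.≤ j → xe F i ≤ xe F j
  xe-mono {i} {j} i≤j rewrite xe-vertex i | xe-vertex j =
    proj₁ (pathVertex-mono _ ending (s≤s i≤j))

  ye-antitone : ∀ {i j} → i Fin.≤ j → ye F j ≤ ye F i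
  ye-antitone {i} {j} i≤j rewrite ye-vertex i | ye-vertex j =
    proj₂ (pathVertex-mono _ ending (inject₁-mono i≤j))

module _ {n : ℕ} (F : AltShape (suc n)) where
  open AltShape F

  eF-vertex : + eF F ≡ proj₁ (Pv F (fromℕ (suc n)))
  eF-vertex = sym (pathVertex-countE _ start)

  xs-last≤eF : xs F (fromℕ n) ≤ + eF F
  xs-last≤eF = subst₂ _≤_ (sym (xs-vertex F (fromℕ n))) (sym eF-vertex)
                 (proj₁ (pathVertex-step-x _ start (fromℕ n)))

  eF≤xs-last+1 : + eF F ≤ xs F (fromℕ n) + + 1
  eF≤xs-last+1 = subst₂ _≤_ (sym eF-vertex) (cong (_+ + 1) (sym (xs-vertex F (fromℕ n))))
                   (proj₂ (pathVertex-step-x _ start (fromℕ n)))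

  ys-first≤0 : ys F zero ≤ + 0
  ys-first≤0 rewrite ys-vertex F zero = proj₁ (pathVertex-step-y _ start zero)

  0≤ys-first+1 : + 0 ≤ ys F zero + + 1
  0≤ys-first+1 rewrite ys-vertex F zero = proj₂ (pathVertex-step-y _ start zero)

  xe-first≤t+1 : xe F zero ≤ + t + + 1
  xe-first≤t+1 rewrite xe-vertex F zero = proj₂ (pathVertex-step-x _ ending zero)

_≼_ : Cell → Cell → Set
c ≼ c′ = proj₁ c ≤ proj₁ c′ × proj₂ c ≤ proj₂ c′

≼-trans : ∀ {a b c} → a ≼ b → b ≼ c → a ≼ c
≼-trans (x≤ , y≤) (x≤′ , y≤′) = ℤP.≤-trans x≤ x≤′ , ℤP.≤-trans y≤ y≤′

≼-nextCell : ∀ c d → c ≼ nextCell c d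
≼-nextCell (i , j) east  = ℤP.i≤i+j i (+ 1) , ℤP.≤-refl
≼-nextCell (i , j) north = ℤP.≤-refl , ℤP.i≤i+j j (+ 1)

module _ {n : ℕ} (F : AltShape n) where
  open AltShape F

  exitsAt⇒≼lastCell : ∀ {c d k} → ExitsAt F c d k → c ≼ lastCell F k
  exitsAt⇒≼lastCell {i , j} {east} {k} (e , q) with ending k | Qv F (inject₁ k)
  exitsAt⇒≼lastCell {i , j} {east} (refl , refl) | .S | ._ =
    ℤP.≤-reflexive (sym (i+1-1≡i i)) , ℤP.≤-reflexive (sym (i+1-1≡i j))
  exitsAt⇒≼lastCell {i , j} {north} {k} (e , q) with ending k | Qv F (inject₁ k)
  exitsAt⇒≼lastCell {i , j} {north} (refl , refl) | .E | ._ =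
    ℤP.≤-refl , ℤP.≤-reflexive (sym (i+1-1≡i j))

  run⇒≼lastCell : ∀ {P c d cs k} → Run F P c d cs k → c ≼ lastCell F k
  run⇒≼lastCell (done exits) = exitsAt⇒≼lastCell exits
  run⇒≼lastCell {P} {c} {d} (go _ run) =
    ≼-trans (≼-nextCell c (out (P c) d)) (run⇒≼lastCell run)

  reaches⇒xs<xe×ys<ye : ∀ {P p k} → Reaches F P p k → xs F p < xe F k × ys F p < ye F k
  reaches⇒xs<xe×ys<ye (_ , run) with run⇒≼lastCell run
  ... | x≤ , y≤ = i≤j⇒i<j+1 x≤ , i≤j⇒i<j+1 y≤

lemma3p4 : ∀ (m : ℕ) (F : AltShape (suc (suc m))) → Complete F →
           ∀ (P : Cell → Tile) (ω : Fin (suc (suc m)) → Fin (suc (suc m))) →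
           IsPipeDream F P ω →
           ((∀ p → xs F p ≤ xs F (fromℕ (suc m))) ×
            xs F (fromℕ (suc m)) < xe F zero ×
            (∀ i → xe F zero ≤ xe F i))
           ×
           ((∀ p → ys F p ≤ ys F zero) ×
            ys F zero < ye F (fromℕ (suc m)) ×
            (∀ i → ye F (fromℕ (suc m)) ≤ ye F i))
           ×
           (xs F (fromℕ (suc m)) ≤ + eF F × + eF F ≤ xe F zero)
           ×
           (ys F zero ≤ + 0 × + 0 ≤ ye F (fromℕ (suc m)))
           ×
           (eF F ℕ.≤ AltShape.t F ℕ.+ 1)
lemma3p4 m F (_ , ω₀-dream , _) _ _ _ =
  (xs-mono F ∘ ≤fromℕ , xs-last<xe-first , (λ _ → xe-mono F z≤n)) ,
  ((λ _ → ys-antitone F z≤n) , ys-first<ye-last , ye-antitone F ∘ ≤fromℕ) ,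
  (xs-last≤eF F , eF≤xe-first) ,
  (ys-first≤0 F , 0≤ye-last) ,
  ℤP.drop‿+≤+ (ℤP.≤-trans eF≤xe-first (xe-first≤t+1 F))
  where
  last : Fin (suc (suc m))
  last = fromℕ (suc m)

  xs-last<xe-first : xs F last < xe F zero
  xs-last<xe-first = proj₁ (reaches⇒xs<xe×ys<ye F (ω₀-dream zero))

  ys-first<ye-last : ys F zero < ye F last
  ys-first<ye-last = proj₂ (reaches⇒xs<xe×ys<ye F
    (subst (λ p → Reaches F _ p last) (opposite-involutive zero) (ω₀-dream last)))

  eF≤xe-first : + eF F ≤ xe F zero
  eF≤xe-first = ℤP.≤-trans (eF≤xs-last+1 F) (i<j⇒i+1≤j xs-last<xe-first)

  0≤ye-last : + 0 ≤ ye F last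
  0≤ye-last = ℤP.≤-trans (0≤ys-first+1 F) (i<j⇒i+1≤j ys-first<ye-last)
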